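{- Any insertion sequence of length $l$ with no repeated insertion sites using $k$ monomer types forming $m$ insertion sets has $m=\Omega(\sqrt{k})$.
   Context: An insertion system has symbols each with a complement ($\overline s=s^*$, $\overline{s^*}=s$), monomer types $(a,b,c,d)^+$ or $(a,b,c,d)^-$, and an initiator $(a,b)(c,d)$ with $\overline a=d$ or $\overline b=c$. In a polymer, each pair of adjacent monomer ends $(a,b)(c,d)$ is an insertion site. Into a site $(a,b)(c,d)$: if $\overline a=d$, any $(\overline b,e,f,\overline c)^+$ can be inserted, producing sites $(a,b)(\overline b,e)$ and $(f,\overline c)(c,d)$; if $\overline b=c$, any $(e,\overline a,\overline d,f)^-$ can be inserted, producing sites $(a,b)(e,\overline a)$ and $(\overline d,f)(c,d)$. An insertion sequence is a sequence of monomer insertions in which each insertion is into a site created by the previous insertion; its length is the number of insertions. An insertion set is a maximal set of same-signed monomer types sharing a common set of insertion sites into which each can be inserted (equivalently, positive types grouped by (first, fourth) symbols, negative types by (second, third) symbols). Here $k$ is the number of distinct monomer types inserted in the sequence and $m$ the number of insertion sets they form. -}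

module Defs where

open import Data.Nat using (ℕ)
open import Data.Nat.Properties using () renaming (_≟_ to _≟ℕ_)
open import Data.Bool using (Bool; true; false; not)
open import Data.Bool.Properties using () renaming (_≟_ to _≟B_)
open import Data.Product using (_×_; _,_; proj₁; proj₂)
open import Data.Product.Properties using (≡-dec)
open import Data.List using (List; []; _∷_; length; map; deduplicate)
open import Relation.Binary.PropositionalEquality using (_≡_)
open import Relation.Binary.Definitions using (DecidableEquality)

-- Symbols: a base name together with a "starred" flag; s = (n , false), s* = (n , true).
Sym : Set
Sym = ℕ × Bool

comp : Sym → Sym
comp (n , b) = (n , not b)

_≟Sym_ : DecidableEquality Sym
_≟Sym_ = ≡-dec _≟ℕ_ _≟B_

-- Sign of a monomer type: true = +, false = -
Sign : Set
Sign = Bool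

-- Monomer type (a,b,c,d)^σ  encoded as (σ , a , b , c , d)
Monomer : Set
Monomer = Sign × Sym × Sym × Sym × Sym

sgn : Monomer → Sign
sgn (σ , _ , _ , _ , _) = σ
m1 m2 m3 m4 : Monomer → Sym
m1 (_ , a , _ , _ , _) = a
m2 (_ , _ , b , _ , _) = b
m3 (_ , _ , _ , c , _) = c
m4 (_ , _ , _ , _ , d) = d

_≟Mon_ : DecidableEquality Monomer
_≟Mon_ = ≡-dec _≟B_ (≡-dec _≟Sym_ (≡-dec _≟Sym_ (≡-dec _≟Sym_ _≟Sym_)))

-- Insertion site (a,b)(c,d) encoded as (a , b , c , d)
Site : Set
Site = Sym × Sym × Sym × Sym

site : Sym → Sym → Sym → Sym → Site
site a b c d = (a , b , c , d)

s1 s2 s3 s4 : Site → Sym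
s1 (a , _ , _ , _) = a
s2 (_ , b , _ , _) = b
s3 (_ , _ , c , _) = c
s4 (_ , _ , _ , d) = d

-- Insert s x s' : monomer x can be inserted into site s, and s' is one of the
-- two sites created by that insertion.
--  positive: s = (a,b)(c,d), ā = d, x = (b̄,e,f,c̄)^+ ; creates (a,b)(b̄,e) and (f,c̄)(c,d)
--  negative: s = (a,b)(c,d), b̄ = c, x = (e,ā,d̄,f)^- ; creates (a,b)(e,ā) and (d̄,f)(c,d)
data Insert (s : Site) (x : Monomer) : Site → Set where
  pos-left  : sgn x ≡ true → comp (s1 s) ≡ s4 s → m1 x ≡ comp (s2 s) → m4 x ≡ comp (s3 s) →
              Insert s x (site (s1 s) (s2 s) (m1 x) (m2 x))
  pos-right : sgn x ≡ true → comp (s1 s) ≡ s4 s → m1 x ≡ comp (s2 s) → m4 x ≡ comp (s3 s) →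
              Insert s x (site (m3 x) (m4 x) (s3 s) (s4 s))
  neg-left  : sgn x ≡ false → comp (s2 s) ≡ s3 s → m2 x ≡ comp (s1 s) → m3 x ≡ comp (s4 s) →
              Insert s x (site (s1 s) (s2 s) (m1 x) (m2 x))
  neg-right : sgn x ≡ false → comp (s2 s) ≡ s3 s → m2 x ≡ comp (s1 s) → m3 x ≡ comp (s4 s) →
              Insert s x (site (m3 x) (m4 x) (s3 s) (s4 s))

-- InsSeq s ss xs : an insertion sequence starting with an insertion into site s,
-- where ss lists the sites inserted into (in order) and xs the monomer types
-- inserted (in order); each insertion is into a site created by the previous one.
-- Its length is length xs.
data InsSeq : Site → List Site → List Monomer → Set where
  done : ∀ {s} → InsSeq s [] []
  step : ∀ {s s' x ss xs} → Insert s x s' → InsSeq s' ss xs → InsSeq s (s ∷ ss) (x ∷ xs)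

InsSetKey : Set
InsSetKey = Sign × Sym × Sym

insSet : Monomer → InsSetKey
insSet (true  , a , b , c , d) = (true  , a , d)
insSet (false , a , b , c , d) = (false , b , c)

_≟Key_ : DecidableEquality InsSetKey
_≟Key_ = ≡-dec _≟B_ (≡-dec _≟Sym_ _≟Sym_)

numTypes : List Monomer → ℕ
numTypes xs = length (deduplicate _≟Mon_ xs)

numSets : List Monomer → ℕ
numSets xs = length (deduplicate _≟Key_ (map insSet xs))

module Submission where

-- A site that accepts an insertion of a monomer type x is
-- determined by the insertion set of x together with ONE symbol σ of the site
-- (its first symbol if x is positive, its second if x is negative): it is
-- siteFor (insSet x) σ below.  Along an insertion sequence every such σ lies in the
-- closure under complement of
--     B = (the two symbols of each insertion set used) ++ (two initiator symbols),
-- because each created site inherits one half (first two or last two symbols)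
-- of its parent, and one half of siteFor k σ already contains σ or σ̄.
-- Hence, with m insertion sets, the inserted-into sites lie in a list of
-- m · 2(2m + 2) sites; if they are pairwise distinct the sequence has at most
-- that many insertions, so k ≤ l ≤ 4m² + 4m ≤ 8m².

open import Defs
open import Data.Nat using (ℕ; _≤_; _*_; _+_; suc; zero; z≤n; s≤s)
open import Data.Nat.Properties
  using (+-suc; m≤m*n; +-monoʳ-≤; *-monoʳ-≤; module ≤-Reasoning)
open import Data.Nat.Tactic.RingSolver using (solve-∀)
open import Data.Bool using (true; false)
open import Data.Bool.Properties using (not-involutive)
open import Data.Product using (∃-syntax; ∃₂; _×_; _,_)
open import Data.Sum using (_⊎_; inj₁; inj₂)
open import Data.List
  using (List; []; _∷_; length; map; deduplicate; _++_; cartesianProductWith)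
open import Data.List.Properties using (length-deduplicate; length-++; length-map; length-removeAt′)
open import Data.List.Relation.Unary.Unique.Propositional using (Unique)
open import Data.List.Relation.Unary.AllPairs using ([]; _∷_)
open import Data.List.Relation.Unary.All as All using (All; []; _∷_)
open import Data.List.Relation.Unary.Any using (here; there; _─_)
open import Data.List.Membership.Propositional using (_∈_)
open import Data.List.Membership.Propositional.Properties
  using (∈-++⁺ˡ; ∈-++⁺ʳ; ∈-++⁻; ∈-map⁺; ∈-map⁻; ∈-deduplicate⁺; ∈-cartesianProductWith⁺)
open import Relation.Binary.PropositionalEquality
open import Relation.Nullary using (¬_; contradiction)

comp-involutive : ∀ σ → comp (comp σ) ≡ σ
comp-involutive (n , b) = cong (n ,_) (not-involutive b)

module _ {A : Set} where

  ∈-─ : ∀ {y z : A} {L : List A} → z ∈ L → ¬ y ≡ z → (p : y ∈ L) → z ∈ (L ─ p)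
  ∈-─ (here refl) y≢z (here refl) = contradiction refl y≢z
  ∈-─ (there z∈L) y≢z (here _)    = z∈L
  ∈-─ (here z≡x)  y≢z (there p)   = here z≡x
  ∈-─ (there z∈L) y≢z (there p)   = there (∈-─ z∈L y≢z p)

  unique-length-≤ : ∀ {ys : List A} (L : List A) → Unique ys → All (_∈ L) ys →
                    length ys ≤ length L
  unique-length-≤ L [] [] = z≤n
  unique-length-≤ L (y∉ys ∷ u) (y∈L ∷ ys⊆L) =
    subst (_ ≤_) (sym (length-removeAt′ L _))
      (s≤s (unique-length-≤ (L ─ y∈L) u (All.zipWith (λ (z∈L , y≢z) → ∈-─ z∈L y≢z y∈L)
                                                      (ys⊆L , y∉ys))))

length-cartesianProductWith : ∀ {A B C : Set} (f : A → B → C) xs ys →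
  length (cartesianProductWith f xs ys) ≡ length xs * length ys
length-cartesianProductWith f []       ys = refl
length-cartesianProductWith f (x ∷ xs) ys = begin
  length (map (f x) ys ++ cartesianProductWith f xs ys)
    ≡⟨ length-++ (map (f x) ys) ⟩
  length (map (f x) ys) + length (cartesianProductWith f xs ys)
    ≡⟨ cong₂ _+_ (length-map (f x) ys) (length-cartesianProductWith f xs ys) ⟩
  length ys + length xs * length ys ∎
  where open ≡-Reasoning

key₁ key₂ : InsSetKey → Sym
key₁ (_ , a , _) = a
key₂ (_ , _ , b) = b

siteFor : InsSetKey → Sym → Site
siteFor (true  , a , d) σ = (σ , comp a , comp d , comp σ)
siteFor (false , b , c) σ = (comp b , σ , comp σ , comp c)

anchor : Monomer → Site → Sym
anchor (true  , _) s = s1 s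
anchor (false , _) s = s2 s

positive-shape : ∀ {s x} → sgn x ≡ true → comp (s1 s) ≡ s4 s →
                 m1 x ≡ comp (s2 s) → m4 x ≡ comp (s3 s) →
                 s ≡ siteFor (insSet x) (anchor x s)
positive-shape {a , b , c , d} {true , _} refl refl refl refl
  rewrite comp-involutive b | comp-involutive c = refl

negative-shape : ∀ {s x} → sgn x ≡ false → comp (s2 s) ≡ s3 s →
                 m2 x ≡ comp (s1 s) → m3 x ≡ comp (s4 s) →
                 s ≡ siteFor (insSet x) (anchor x s)
negative-shape {a , b , c , d} {false , _} refl refl refl refl
  rewrite comp-involutive a | comp-involutive d = refl

accepting-shape : ∀ {s x s'} → Insert s x s' → s ≡ siteFor (insSet x) (anchor x s)
accepting-shape (pos-left  σ e p q) = positive-shape σ e p q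
accepting-shape (pos-right σ e p q) = positive-shape σ e p q
accepting-shape (neg-left  σ e p q) = negative-shape σ e p q
accepting-shape (neg-right σ e p q) = negative-shape σ e p q

inherits-half : ∀ {s x s'} → Insert s x s' →
                (s1 s' ≡ s1 s × s2 s' ≡ s2 s) ⊎ (s3 s' ≡ s3 s × s4 s' ≡ s4 s)
inherits-half (pos-left  _ _ _ _) = inj₁ (refl , refl)
inherits-half (pos-right _ _ _ _) = inj₂ (refl , refl)
inherits-half (neg-left  _ _ _ _) = inj₁ (refl , refl)
inherits-half (neg-right _ _ _ _) = inj₂ (refl , refl)

module Coding (G : Sym → Set) (G-comp : ∀ {σ} → G σ → G (comp σ))
              (K : InsSetKey → Set) (K-good : ∀ {k} → K k → G (key₁ k) × G (key₂ k)) where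

  G-comp⁻ : ∀ {σ} → G (comp σ) → G σ
  G-comp⁻ {σ} g = subst G (comp-involutive σ) (G-comp g)

  Good : Site → Set
  Good s = G (s1 s) × G (s2 s) × G (s3 s) × G (s4 s)

  HalfGood : Site → Set
  HalfGood s = (G (s1 s) × G (s2 s)) ⊎ (G (s3 s) × G (s4 s))

  Coded : Site → Set
  Coded s = ∃₂ λ k σ → K k × G σ × s ≡ siteFor k σ

  siteFor-good : ∀ {k σ} → K k → G σ → Good (siteFor k σ)
  siteFor-good {true  , _} κ g = let (ga , gd) = K-good κ in g , G-comp ga , G-comp gd , G-comp g
  siteFor-good {false , _} κ g = let (gb , gc) = K-good κ in G-comp gb , g , G-comp g , G-comp gc

  -- Either half of siteFor k σ determines σ up to complement.
  anchor-good : ∀ k σ → HalfGood (siteFor k σ) → G σ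
  anchor-good (true  , _) σ (inj₁ (g , _)) = g
  anchor-good (true  , _) σ (inj₂ (_ , g)) = G-comp⁻ g
  anchor-good (false , _) σ (inj₁ (_ , g)) = g
  anchor-good (false , _) σ (inj₂ (g , _)) = G-comp⁻ g

  inherit : ∀ {s x s'} → Good s → Insert s x s' → HalfGood s'
  inherit (ga , gb , gc , gd) ins with inherits-half ins
  ... | inj₁ (refl , refl) = inj₁ (ga , gb)
  ... | inj₂ (refl , refl) = inj₂ (gc , gd)

  all-coded : ∀ {s ss xs} → InsSeq s ss xs → All (λ x → K (insSet x)) xs → HalfGood s →
              All Coded ss
  all-coded done [] h = []
  all-coded {s} (step {x = x} ins rest) (κ ∷ κs) h =
    (insSet x , anchor x s , κ , g , shape) ∷ all-coded rest κs (inherit good ins)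
    where
    shape : s ≡ siteFor (insSet x) (anchor x s)
    shape = accepting-shape ins
    g : G (anchor x s)
    g = anchor-good (insSet x) (anchor x s) (subst HalfGood shape h)
    good : Good s
    good = subst Good (sym shape) (siteFor-good κ g)

keySymbols : List InsSetKey → List Sym
keySymbols []       = []
keySymbols (k ∷ ks) = key₁ k ∷ key₂ k ∷ keySymbols ks

length-keySymbols : ∀ ks → length (keySymbols ks) ≡ length ks + length ks
length-keySymbols []       = refl
length-keySymbols (k ∷ ks) =
  cong suc (trans (cong suc (length-keySymbols ks)) (sym (+-suc (length ks) (length ks))))

∈-keySymbols : ∀ {k ks} → k ∈ ks → key₁ k ∈ keySymbols ks × key₂ k ∈ keySymbols ks
∈-keySymbols (here refl) = here refl , there (here refl)
∈-keySymbols (there p)   = let (a , b) = ∈-keySymbols p in there (there a) , there (there b)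

compClosure : List Sym → List Sym
compClosure B = B ++ map comp B

compClosure-comp : ∀ {σ} B → σ ∈ compClosure B → comp σ ∈ compClosure B
compClosure-comp B p with ∈-++⁻ B p
... | inj₁ q = ∈-++⁺ʳ B (∈-map⁺ comp q)
... | inj₂ q with ∈-map⁻ comp q
...   | b , b∈B , refl = ∈-++⁺ˡ (subst (_∈ B) (sym (comp-involutive b)) b∈B)

-- |candidates| = m · 2(2m + 2) = 4m² + 4m ≤ 8m².
insertions-bound : ∀ m → m * ((m + m + 2) + (m + m + 2)) ≤ 8 * (m * m)
insertions-bound m = begin
  m * ((m + m + 2) + (m + m + 2)) ≡⟨ expand m ⟩
  4 * (m * m) + 4 * m             ≤⟨ +-monoʳ-≤ (4 * (m * m)) (*-monoʳ-≤ 4 (m≤m*m m)) ⟩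
  4 * (m * m) + 4 * (m * m)       ≡⟨ collect m ⟩
  8 * (m * m)                     ∎
  where
  open ≤-Reasoning
  m≤m*m : ∀ m → m ≤ m * m
  m≤m*m zero    = z≤n
  m≤m*m (suc n) = m≤m*n (suc n) (suc n)
  expand : ∀ m → m * ((m + m + 2) + (m + m + 2)) ≡ 4 * (m * m) + 4 * m
  expand = solve-∀
  collect : ∀ m → 4 * (m * m) + 4 * (m * m) ≡ 8 * (m * m)
  collect = solve-∀

length-InsSeq : ∀ {s ss xs} → InsSeq s ss xs → length ss ≡ length xs
length-InsSeq done       = refl
length-InsSeq (step _ r) = cong suc (length-InsSeq r)

-- Main theorem: k ≤ l ≤ |candidates| ≤ 8m², the middle step because the
-- (distinct) sites inserted into are all coded, hence candidates.
sites-bound : ∀ s ss xs → InsSeq s ss xs → Unique ss →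
              numTypes xs ≤ 8 * (numSets xs * numSets xs)
sites-bound s ss xs seq unique = begin
  numTypes xs                     ≤⟨ length-deduplicate _≟Mon_ xs ⟩
  length xs                       ≡⟨ sym (length-InsSeq seq) ⟩
  length ss                       ≤⟨ unique-length-≤ candidates unique (All.map toCandidate coded) ⟩
  length candidates               ≡⟨ length-candidates ⟩
  m * ((m + m + 2) + (m + m + 2)) ≤⟨ insertions-bound m ⟩
  8 * (m * m)                     ∎
  where
  open ≤-Reasoning
  keys : List InsSetKey
  keys = deduplicate _≟Key_ (map insSet xs)
  m : ℕ
  m = length keys
  B : List Sym
  B = keySymbols keys ++ (s1 s ∷ s2 s ∷ [])
  SL : List Sym
  SL = compClosure B
  candidates : List Site
  candidates = cartesianProductWith siteFor keys SL

  K-good : ∀ {k} → k ∈ keys → key₁ k ∈ SL × key₂ k ∈ SL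
  K-good κ = let (a , b) = ∈-keySymbols κ in ∈-++⁺ˡ (∈-++⁺ˡ a) , ∈-++⁺ˡ (∈-++⁺ˡ b)

  open Coding (_∈ SL) (compClosure-comp B) (_∈ keys) K-good

  initiator : ∀ {σ} → σ ∈ s1 s ∷ s2 s ∷ [] → σ ∈ SL
  initiator q = ∈-++⁺ˡ (∈-++⁺ʳ (keySymbols keys) q)

  coded : All Coded ss
  coded = all-coded seq (All.tabulate (λ x∈xs → ∈-deduplicate⁺ _≟Key_ (∈-map⁺ insSet x∈xs)))
                    (inj₁ (initiator (here refl) , initiator (there (here refl))))

  toCandidate : ∀ {t} → Coded t → t ∈ candidates
  toCandidate (k , σ , κ , g , refl) = ∈-cartesianProductWith⁺ siteFor κ g

  length-B : length B ≡ m + m + 2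
  length-B = trans (length-++ (keySymbols keys)) (cong (_+ 2) (length-keySymbols keys))

  length-candidates : length candidates ≡ m * ((m + m + 2) + (m + m + 2))
  length-candidates = trans (length-cartesianProductWith siteFor keys SL)
    (cong (m *_) (trans (length-++ B) (cong₂ _+_ length-B (trans (length-map comp B) length-B))))

lemma7 : ∃[ C ] (∀ (s : Site) (ss : List Site) (xs : List Monomer) →
           InsSeq s ss xs → Unique ss →
           numTypes xs ≤ C * (numSets xs * numSets xs))
lemma7 = 8 , sites-bound
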